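{- For any connected building set $\mathcal{B}$ on $[n]$, the $q$-$h$-polynomial of the nestohedron $P_{\mathcal{B}}$ is \[ h_{\mathcal{B}}(t,q)=\sum_T t^{\mathrm{des}(T)}q^{\mathrm{maj}(T)}, \] where the sum is over all $\mathcal{B}$-trees $T$.
   Context: A building set on $[n]$ is a collection $\mathcal{B}$ of nonempty subsets of $[n]$ closed under unions of intersecting members and containing all singletons; it is connected if $[n]\in\mathcal{B}$. The nestohedron is $P_{\mathcal{B}}=\sum_{I\in\mathcal{B}}y_I\Delta_I\subset\mathbb{R}^n$, $y_I>0$, $\Delta_I=\mathrm{conv}\{e_i:i\in I\}$; it is a simple generalized permutohedron (its normal fan, in $(\mathbb{R}^n)^\ast/(1,\ldots,1)$, where the normal cone of a face consists of the linear functionals maximized on all of that face, is refined by the braid fan with cones $\{x_{\pi_1}\le\cdots\le x_{\pi_n}\}$, $\pi\in S_n$). For a full-dimensional cone $\sigma$ of the normal fan, $Q_\sigma$ is the poset on $[n]$ with $i\le j$ iff $x_i\le x_j$ for all $x\in\sigma$; it is graded, and $\rho_\sigma$ denotes its minimal rank function (rank function: $\rho\ge0$ and $\rho(y)=\rho(x)+1$ whenever $y$ covers $x$; minimal: $\rho-1$ is not a rank function). For such a poset $Q$, $\mathrm{Des}(Q)=\{(i,j): j \text{ covers } i \text{ in } Q,\ i>j \text{ as integers}\}$, $\mathrm{des}(Q)=|\mathrm{Des}(Q)|$, $\mathrm{maj}(Q)=\sum_{(i,j)\in\mathrm{Des}(Q)}\rho(j)$. The $q$-$h$-polynomial of a simple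 generalized permutohedron $P$ is $h_P(t,q)=\sum_\sigma t^{\mathrm{des}(Q_\sigma)}q^{\mathrm{maj}(Q_\sigma)}$, over full-dimensional cones $\sigma$ of its normal fan; $h_{\mathcal{B}}(t,q):=h_{P_{\mathcal{B}}}(t,q)$. For a rooted tree $T$ on $[n]$ and a vertex $i$, $T_{\le i}$ is the set of $i$ and its descendants. A $\mathcal{B}$-tree is a rooted tree $T$ on $[n]$ with $T_{\le i}\in\mathcal{B}$ for all $i$, and $\bigcup_{j=1}^k T_{\le i_j}\notin\mathcal{B}$ for any $k\ge2$ pairwise incomparable (neither a descendant of the other) nodes $i_1,\ldots,i_k$. Write $x\lessdot_T y$ if $\{x,y\}$ is an edge of $T$ with $y$ closer to the root. $\mathrm{Des}(T)=\{(i,j): i\lessdot_T j,\ i>j\}$, $\mathrm{des}(T)=|\mathrm{Des}(T)|$; $\mathrm{dp}(x)$ is the length of the path from $x$ to the root, $\mathrm{depth}(T)=\max_x\mathrm{dp}(x)$, and $\mathrm{maj}(T)=\sum_{(i,j)\in\mathrm{Des}(T)}(\mathrm{depth}(T)-\mathrm{dp}(j))$. -}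

module Defs where

open import Level using (0ℓ)
open import Function using (_∘_)
open import Data.Bool using (Bool)
open import Data.Nat as ℕ using (ℕ; zero; suc; _⊔_; _∸_)
open import Data.Fin as Fin using (Fin; toℕ)
open import Data.Fin.Properties as FinP using (any?)
open import Data.Fin.Subset using (Subset; _∈_; _∩_; _∪_; ⁅_⁆; ⊤; Nonempty; ∣_∣; ⋃)
open import Data.Fin.Subset.Properties using (_∈?_; anySubset?)
open import Data.Vec as Vec using (Vec; []; _∷_; lookup; tabulate)
open import Data.List as List using (List; []; _∷_; map; concatMap; filter; length; allFin; foldr; cartesianProduct; deduplicate)
open import Data.Nat.ListAction using (sum)
open import Data.List.Relation.Unary.All as All using (All)
open import Data.Maybe using (Maybe; just; nothing; is-nothing)
import Data.Maybe.Properties as MaybeP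
open import Data.Product using (Σ; ∃; _×_; _,_; proj₁; proj₂)
open import Relation.Unary using (Pred)
open import Relation.Binary.PropositionalEquality using (_≡_; _≢_)
open import Relation.Nullary using (¬_; Dec; yes; no; ¬?; does)
open import Relation.Nullary.Decidable using (_×-dec_; _→-dec_; decidable-stable)
import Relation.Unary as U
import Relation.Binary as Bin

allVecsOver : {A : Set} → List A → (k : ℕ) → List (Vec A k)
allVecsOver xs zero    = [] ∷ []
allVecsOver xs (suc k) = concatMap (λ x → map (x ∷_) (allVecsOver xs k)) xs

allFin? : ∀ {n} {P : Fin n → Set} → U.Decidable P → Dec (∀ i → P i)
allFin? = FinP.all?

allSubset? : ∀ {n} {P : Subset n → Set} → U.Decidable P → Dec (∀ S → P S)
allSubset? {P = P} P? with anySubset? (λ S → ¬? (P? S))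
... | yes (S , ¬p) = no (λ f → ¬p (f S))
... | no ¬∃        = yes (λ S → decidable-stable (P? S) (λ ¬p → ¬∃ (S , ¬p)))

-- bivariate polynomials in t, q with ℕ coefficients, as coefficient
-- functions: (poly a b) is the coefficient of t^a q^b
Poly2 : Set
Poly2 = ℕ → ℕ → ℕ

-- the polynomial  Σ_{(a,b) ∈ ws} t^a q^b  (ws a list, i.e. a multiset)
monomialSum : List (ℕ × ℕ) → Poly2
monomialSum ws a b =
  length (filter (λ w → (proj₁ w ℕ.≟ a) ×-dec (proj₂ w ℕ.≟ b)) ws)

-- Building sets on [n]  (element i+1 of [n] is  i : Fin n)

record IsBuildingSet {n : ℕ} (B : Pred (Subset n) 0ℓ) : Set where
  field
    members-nonempty : ∀ I → B I → Nonempty I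
    singletons       : ∀ i → B ⁅ i ⁆
    union-closed     : ∀ I J → B I → B J → Nonempty (I ∩ J) → B (I ∪ J)

IsConnected : {n : ℕ} → Pred (Subset n) 0ℓ → Set
IsConnected B = B ⊤

module _ {n : ℕ} (_≼_ : Fin n → Fin n → Set) where

  Covers : Fin n → Fin n → Set
  Covers i j = ((i ≼ j) × (i ≢ j))
             × (∀ k → ¬ (((i ≼ k) × (i ≢ k)) × ((k ≼ j) × (k ≢ j))))

  IsRankFunction : (Fin n → ℕ) → Set
  IsRankFunction ρ = ∀ i j → Covers i j → ρ j ≡ suc (ρ i)

  IsMinimalRankFunction : (Fin n → ℕ) → Set
  IsMinimalRankFunction ρ =
    IsRankFunction ρ
    × ¬ (Σ (Fin n → ℕ) λ ρ' → IsRankFunction ρ' × (∀ x → ρ x ≡ suc (ρ' x)))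

  module _ (_≼?_ : Bin.Decidable _≼_) where

    covers? : Bin.Decidable Covers
    covers? i j =
      ((i ≼? j) ×-dec ¬? (i Fin.≟ j))
      ×-dec allFin? (λ k → ¬? (((i ≼? k) ×-dec ¬? (i Fin.≟ k))
                              ×-dec ((k ≼? j) ×-dec ¬? (k Fin.≟ j))))

    DesPoset : List (Fin n × Fin n)
    DesPoset = filter (λ p → covers? (proj₁ p) (proj₂ p)
                             ×-dec (proj₂ p Fin.<? proj₁ p))
                      (cartesianProduct (allFin n) (allFin n))

    desPoset : ℕ
    desPoset = length DesPoset

    majPoset : (Fin n → ℕ) → ℕ
    majPoset ρ = sum (map (λ p → ρ (proj₂ p)) DesPoset)

-- Braid chambers.  A chamber {x_{π1} ≤ ... ≤ x_{πn}} is encoded by the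
-- ranking r : Vec (Fin n) n with  r[π_k] = k  (r a bijection).

Ranking : ℕ → Set
Ranking n = Vec (Fin n) n

IsPerm : ∀ {n} → Ranking n → Set
IsPerm {n} r = ∀ i j → lookup r i ≡ lookup r j → i ≡ j

isPerm? : ∀ {n} → U.Decidable (IsPerm {n})
isPerm? r = allFin? λ i → allFin? λ j →
  (lookup r i Fin.≟ lookup r j) →-dec (i Fin.≟ j)

perms : (n : ℕ) → List (Ranking n)
perms n = filter isPerm? (allVecsOver (allFin n) n)

-- The nestohedron  P_B = Σ_{I∈B} y_I Δ_I  and its normal fan.

module Nesto {n : ℕ} (B : Pred (Subset n) 0ℓ) (B? : U.Decidable B) where

  -- m is the vertex e_m of Δ_I maximizing every functional in the
  -- (interior of the) chamber r, i.e. m is the r-largest element of I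
  IsMax : Ranking n → Subset n → Fin n → Set
  IsMax r I m = m ∈ I × (∀ i → i ∈ I → lookup r i Fin.≤ lookup r m)

  isMax? : ∀ r I m → Dec (IsMax r I m)
  isMax? r I m = (m ∈? I) ×-dec allFin? (λ i → (i ∈? I) →-dec (lookup r i Fin.≤? lookup r m))

  -- chambers r, r' lie in the same (full-dimensional) normal cone of P_B
  -- iff they maximize the same vertex of P_B, i.e. (Minkowski sum) the
  -- same vertex of every summand Δ_I, I ∈ B  (independent of y_I > 0)
  SameCone : Ranking n → Ranking n → Set
  SameCone r r' = ∀ I → B I → ∀ m →
    (IsMax r I m → IsMax r' I m) × (IsMax r' I m → IsMax r I m)

  sameCone? : Bin.Decidable SameCone
  sameCone? r r' = allSubset? λ I → B? I →-dec allFin? λ m →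
    (isMax? r I m →-dec isMax? r' I m) ×-dec (isMax? r' I m →-dec isMax? r I m)

  -- the full-dimensional cones of the normal fan, each represented by one
  -- braid chamber it contains (one representative per cone)
  cones : List (Ranking n)
  cones = deduplicate sameCone? (perms n)

  _≤Q[_]_ : Fin n → Ranking n → Fin n → Set
  i ≤Q[ r ] j = All (λ r' → SameCone r' r → lookup r' i Fin.≤ lookup r' j) (perms n)

  ≤Q? : ∀ r → Bin.Decidable (λ i j → i ≤Q[ r ] j)
  ≤Q? r i j = All.all? (λ r' → sameCone? r' r →-dec (lookup r' i Fin.≤? lookup r' j)) (perms n)

  -- q-h-polynomial h_B(t,q) = Σ_σ t^des(Q_σ) q^maj(Q_σ), where ρ r is the
  -- (minimal) rank function of Q_σ used to compute maj
  hB : (ρ : Ranking n → Fin n → ℕ) → Poly2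
  hB ρ = monomialSum
    (map (λ r → desPoset (λ i j → i ≤Q[ r ] j) (≤Q? r)
              , majPoset (λ i j → i ≤Q[ r ] j) (≤Q? r) (ρ r))
         cones)

-- Rooted trees on [n], encoded by parent vectors (nothing = root)

ParentVec : ℕ → Set
ParentVec n = Vec (Maybe (Fin n)) n

module Tree {n : ℕ} (p : ParentVec n) where

  step : Maybe (Fin n) → Maybe (Fin n)
  step nothing  = nothing
  step (just x) = lookup p x

  up : ℕ → Fin n → Maybe (Fin n)
  up zero    i = just i
  up (suc k) i = step (up k i)

  -- exactly one root and no cycles (every node reaches the root)
  IsRootedTree : Set
  IsRootedTree = (∣ Vec.map is-nothing p ∣ ≡ 1) × (∀ i → up n i ≡ nothing)

  Below : Fin n → Fin n → Set
  Below j i = ∃ λ (k : Fin n) → up (toℕ k) j ≡ just i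

  below? : Bin.Decidable Below
  below? j i = any? λ k → MaybeP.≡-dec Fin._≟_ (up (toℕ k) j) (just i)

  T≤ : Fin n → Subset n
  T≤ i = tabulate λ j → does (below? j i)

  Incomparable : Fin n → Fin n → Set
  Incomparable i j = ¬ Below i j × ¬ Below j i

  -- dp(x): length of the path from x to the root = number of proper ancestors
  dp : Fin n → ℕ
  dp x = ∣ tabulate (λ i → does (¬? (i Fin.≟ x) ×-dec below? x i)) ∣

  depth : ℕ
  depth = foldr _⊔_ 0 (map dp (allFin n))

  DesTree : List (Fin n × Fin n)
  DesTree = filter (λ q → MaybeP.≡-dec Fin._≟_ (lookup p (proj₁ q)) (just (proj₂ q))
                          ×-dec (proj₂ q Fin.<? proj₁ q))
                   (cartesianProduct (allFin n) (allFin n))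

  desTree : ℕ
  desTree = length DesTree

  majTree : ℕ
  majTree = sum (map (λ q → depth ∸ dp (proj₂ q)) DesTree)

module BTrees {n : ℕ} (B : Pred (Subset n) 0ℓ) (B? : U.Decidable B) where
  open Tree

  unionBelow : ParentVec n → Subset n → Subset n
  unionBelow p S = ⋃ (map (T≤ p) (filter (_∈? S) (allFin n)))

  IsBTree : ParentVec n → Set
  IsBTree p =
    IsRootedTree p
    × (∀ i → B (T≤ p i))
    × (∀ S → 2 ℕ.≤ ∣ S ∣
           → (∀ i j → i ∈ S → j ∈ S → i ≢ j → Incomparable p i j)
           → ¬ B (unionBelow p S))

  isBTree? : U.Decidable IsBTree
  isBTree? p =
    ((ℕ._≟_ ∣ Vec.map is-nothing p ∣ 1)
       ×-dec allFin? (λ i → MaybeP.≡-dec Fin._≟_ (up p n i) nothing))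
    ×-dec allFin? (λ i → B? (T≤ p i))
    ×-dec allSubset? (λ S → (2 ℕ.≤? ∣ S ∣) →-dec
            (allFin? (λ i → allFin? λ j → (i ∈? S) →-dec ((j ∈? S) →-dec
                (¬? (i Fin.≟ j) →-dec (¬? (below? p i j) ×-dec ¬? (below? p j i)))))
             →-dec ¬? (B? (unionBelow p S))))

  bTrees : List (ParentVec n)
  bTrees = filter isBTree? (allVecsOver (nothing ∷ map just (allFin n)) n)

  treePoly : Poly2
  treePoly = monomialSum (map (λ p → desTree p , majTree p) bTrees)

-- For a chamber r, let block r i be the largest member of B in which i is r-maximal (the union of
-- all of them, which lies in B since they share i). The vertex of P_B maximised by r is determined by
-- these blocks, so two chambers lie in the same normal cone iff their blocks agree. The blocks are the
-- subtrees T≤ i of a B-tree, the parent of x being the r-smallest j ≠ x whose block contains x; and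
-- i ≤ j in Q_σ iff i ∈ block r j, because raising everything outside block r j above it gives a
-- chamber of the same cone. Hence the covers of Q_σ are exactly the tree edges (same descents), and
-- a minimal rank function goes up by one along edges and vanishes somewhere, so it equals
-- depth ∸ dp (same maj). Conversely a B-tree is the tree of any linear extension of its tree order,
-- so cones ↦ trees is a bijection onto the B-trees preserving (des, maj).

module Submission where

open import Defs
open import Level using (0ℓ)
open import Function using (_∘_)
open import Function.Bundles using (mk⇔)
open import Data.Bool using (Bool; true)
open import Data.Empty using (⊥-elim)
open import Data.Nat as ℕ using (ℕ; zero; suc; _+_; _*_; _∸_; _≤_; _<_; z≤n; s≤s)
import Data.Nat.Properties as ℕP
open import Data.Nat.ListAction using (sum)
open import Data.Fin as Fin using (Fin; toℕ)
import Data.Fin.Properties as FinP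
open import Data.Fin.Subset using (Subset; _∈_; _∉_; _⊆_; _∩_; _∪_; ⁅_⁆; ⊤; ⊥; Nonempty; Empty; ∣_∣; ⋃; inside; outside)
open import Data.Fin.Subset.Properties
open import Data.Vec as Vec using (Vec; []; _∷_; lookup; tabulate)
import Data.Vec.Properties as VecP
open import Data.Maybe using (Maybe; just; nothing; is-nothing)
import Data.Maybe.Properties as MaybeP
open import Data.Product using (∃; _×_; _,_; proj₁; proj₂)
open import Data.Sum using (_⊎_; inj₁; inj₂; [_,_]′)
open import Data.List as List using (List; []; _∷_; map; filter; foldr; concatMap; allFin; deduplicate; cartesianProduct)
import Data.List.Properties as ListP
open import Data.List.Extrema.Nat using (argmax; argmin; argmax-all; argmin-all; f[xs]≤f[argmax]; f[argmin]≤f[xs])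
open import Data.List.Membership.Propositional using (find) renaming (_∈_ to _∈ₗ_)
open import Data.List.Membership.Propositional.Properties using (∈-filter⁺; ∈-filter⁻; ∈-allFin; ∈-map⁺; ∈-map⁻; ∈-concatMap⁺; ∈-concatMap⁻)
open import Data.List.Membership.Propositional.Properties.WithK using (unique∧set⇒bag)
open import Data.List.Relation.Unary.Any as Any using (here; there)
import Data.List.Relation.Unary.Any.Properties as AnyP
open import Data.List.Relation.Unary.All as All using (All; []; _∷_)
import Data.List.Relation.Unary.All.Properties as AllP
open import Data.List.Relation.Unary.AllPairs using (AllPairs; []; _∷_)
import Data.List.Relation.Unary.AllPairs.Properties as AllPairsP
open import Data.List.Relation.Unary.Unique.Propositional using (Unique)
import Data.List.Relation.Unary.Unique.Propositional.Properties as UniqueP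
open import Data.List.Relation.Binary.Permutation.Propositional using (_↭_)
import Data.List.Relation.Binary.Permutation.Propositional.Properties as PermP
open import Data.List.Relation.Binary.BagAndSetEquality using (∼bag⇒↭)
open import Relation.Unary using (Pred; Decidable)
open import Relation.Binary using (tri<; tri≈; tri>)
open import Relation.Binary.PropositionalEquality
open import Relation.Nullary using (¬_; Dec; yes; no; ¬?; does)
open import Relation.Nullary.Decidable using (_×-dec_; _→-dec_; dec-true)

module _ {n : ℕ} where

  ∈-tabulate⁺ : (f : Fin n → Bool) {x : Fin n} → f x ≡ true → x ∈ tabulate f
  ∈-tabulate⁺ f {x} fx = VecP.lookup⇒[]= x (tabulate f) (trans (VecP.lookup∘tabulate f x) fx)

  ∈-tabulate⁻ : (f : Fin n → Bool) {x : Fin n} → x ∈ tabulate f → f x ≡ true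
  ∈-tabulate⁻ f {x} x∈ = trans (sym (VecP.lookup∘tabulate f x)) (VecP.[]=⇒lookup x∈)

  module _ {P : Fin n → Set} (P? : Decidable P) where

    ∈-tabulate-does⁺ : ∀ {x} → P x → x ∈ tabulate (does ∘ P?)
    ∈-tabulate-does⁺ {x} px = ∈-tabulate⁺ (does ∘ P?) (dec-true (P? x) px)

    ∈-tabulate-does⁻ : ∀ {x} → x ∈ tabulate (does ∘ P?) → P x
    ∈-tabulate-does⁻ {x} x∈ with P? x | ∈-tabulate⁻ (does ∘ P?) x∈
    ... | yes px | _ = px
    ... | no _   | ()

  only-element⇒∣p∣≡1 : ∀ {p : Subset n} {m} → m ∈ p → (∀ {x} → x ∈ p → x ≡ m) → ∣ p ∣ ≡ 1
  only-element⇒∣p∣≡1 {p} {m} m∈p unique = trans (cong ∣_∣ (⊆-antisym p⊆⁅m⁆ ⁅m⁆⊆p)) (∣⁅x⁆∣≡1 m)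
    where
    p⊆⁅m⁆ : p ⊆ ⁅ m ⁆
    p⊆⁅m⁆ x∈p = subst (_∈ ⁅ m ⁆) (sym (unique x∈p)) (x∈⁅x⁆ m)
    ⁅m⁆⊆p : ⁅ m ⁆ ⊆ p
    ⁅m⁆⊆p {x} x∈⁅m⁆ = subst (_∈ p) (sym (x∈⁅y⁆⇒x≡y m x∈⁅m⁆)) m∈p

  0<∣p∣⇒Nonempty : ∀ (p : Subset n) → 1 ≤ ∣ p ∣ → Nonempty p
  0<∣p∣⇒Nonempty p 1≤∣p∣ with nonempty? p
  ... | yes ne = ne
  ... | no empty = ⊥-elim (ℕP.<⇒≢ 1≤∣p∣ (sym (trans (cong ∣_∣ (Empty-unique empty)) (∣⊥∣≡0 n))))

  another-element : ∀ (p : Subset n) {x} → 2 ≤ ∣ p ∣ → x ∈ p → ∃ λ y → y ∈ p × y ≢ x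
  another-element p {x} 2≤∣p∣ x∈p with FinP.any? (λ y → (y ∈? p) ×-dec ¬? (y Fin.≟ x))
  ... | yes found = found
  ... | no none = ⊥-elim (ℕP.<⇒≱ 2≤∣p∣ (subst (∣ p ∣ ≤_) (∣⁅x⁆∣≡1 x) (p⊆q⇒∣p∣≤∣q∣ p⊆⁅x⁆)))
    where
    p⊆⁅x⁆ : p ⊆ ⁅ x ⁆
    p⊆⁅x⁆ {y} y∈p with y Fin.≟ x
    ... | yes refl = x∈⁅x⁆ x
    ... | no y≢x = ⊥-elim (none (y , y∈p , y≢x))

  distinct⇒2≤∣p∣ : ∀ (p : Subset n) {x y} → x ∈ p → y ∈ p → x ≢ y → 2 ≤ ∣ p ∣
  distinct⇒2≤∣p∣ p {x} {y} x∈p y∈p x≢y = subst (_< ∣ p ∣) (∣⁅x⁆∣≡1 x)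
    (p⊂q⇒∣p∣<∣q∣ ( (λ z∈⁅x⁆ → subst (_∈ p) (sym (x∈⁅y⁆⇒x≡y x z∈⁅x⁆)) x∈p)
                  , y , y∈p , x≢y ∘ sym ∘ x∈⁅y⁆⇒x≡y x))

∣⁅x⁆∪p∣≡1+∣p∣ : ∀ {n} {x : Fin n} {p : Subset n} → x ∉ p → ∣ ⁅ x ⁆ ∪ p ∣ ≡ suc ∣ p ∣
∣⁅x⁆∪p∣≡1+∣p∣ {x = Fin.zero}  {outside ∷ p} _   = cong (suc ∘ ∣_∣) (∪-identityˡ p)
∣⁅x⁆∪p∣≡1+∣p∣ {x = Fin.zero}  {inside ∷ p}  x∉p = ⊥-elim (x∉p Vec.here)
∣⁅x⁆∪p∣≡1+∣p∣ {x = Fin.suc x} {outside ∷ p} x∉p = ∣⁅x⁆∪p∣≡1+∣p∣ (x∉p ∘ Vec.there)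
∣⁅x⁆∪p∣≡1+∣p∣ {x = Fin.suc x} {inside ∷ p}  x∉p = cong suc (∣⁅x⁆∪p∣≡1+∣p∣ (x∉p ∘ Vec.there))

module _ {n : ℕ} where

  ∈-foldr-∪⁻ : ∀ {x : Fin n} A Ls → x ∈ foldr _∪_ A Ls → x ∈ A ⊎ ∃ λ L → L ∈ₗ Ls × x ∈ L
  ∈-foldr-∪⁻ A []       x∈A = inj₁ x∈A
  ∈-foldr-∪⁻ A (L ∷ Ls) x∈  with x∈p∪q⁻ L (foldr _∪_ A Ls) x∈
  ... | inj₁ x∈L = inj₂ (L , here refl , x∈L)
  ... | inj₂ x∈Ls with ∈-foldr-∪⁻ A Ls x∈Ls
  ...   | inj₁ x∈A = inj₁ x∈A
  ...   | inj₂ (L′ , L′∈Ls , x∈L′) = inj₂ (L′ , there L′∈Ls , x∈L′)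

  ∈-foldr-∪⁺ˡ : ∀ {x : Fin n} A Ls → x ∈ A → x ∈ foldr _∪_ A Ls
  ∈-foldr-∪⁺ˡ A []       x∈A = x∈A
  ∈-foldr-∪⁺ˡ A (L ∷ Ls) x∈A = x∈p∪q⁺ (inj₂ (∈-foldr-∪⁺ˡ A Ls x∈A))

  ∈-foldr-∪⁺ʳ : ∀ {x : Fin n} A Ls {L} → L ∈ₗ Ls → x ∈ L → x ∈ foldr _∪_ A Ls
  ∈-foldr-∪⁺ʳ A (L ∷ Ls) (here refl) x∈L = x∈p∪q⁺ (inj₁ x∈L)
  ∈-foldr-∪⁺ʳ A (L ∷ Ls) (there L∈Ls) x∈L = x∈p∪q⁺ (inj₂ (∈-foldr-∪⁺ʳ A Ls L∈Ls x∈L))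

  ∈-⋃⁻ : ∀ {x : Fin n} Ls → x ∈ ⋃ Ls → ∃ λ L → L ∈ₗ Ls × x ∈ L
  ∈-⋃⁻ Ls x∈ = [ (λ x∈⊥ → ⊥-elim (∉⊥ x∈⊥)) , (λ found → found) ]′ (∈-foldr-∪⁻ ⊥ Ls x∈)

  ∈-⋃⁺ : ∀ {x : Fin n} Ls {L} → L ∈ₗ Ls → x ∈ L → x ∈ ⋃ Ls
  ∈-⋃⁺ = ∈-foldr-∪⁺ʳ ⊥

  foldr-∪-absorbed : ∀ {S : Subset n} Ls → S ⊆ ⋃ Ls → foldr _∪_ S Ls ≡ ⋃ Ls
  foldr-∪-absorbed {S} Ls S⊆⋃Ls =
    ⊆-antisym ⊆-step (λ x∈ → let _ , L∈ , x∈L = ∈-⋃⁻ Ls x∈ in ∈-foldr-∪⁺ʳ S Ls L∈ x∈L)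
    where
    ⊆-step : foldr _∪_ S Ls ⊆ ⋃ Ls
    ⊆-step x∈ with ∈-foldr-∪⁻ S Ls x∈
    ... | inj₁ x∈S              = S⊆⋃Ls x∈S
    ... | inj₂ (_ , L∈ , x∈L)  = ∈-⋃⁺ Ls L∈ x∈L

module _ {A : Set} {n : ℕ} where

  ∈-map-is-nothing⁺ : ∀ (v : Vec (Maybe A) n) {x} → lookup v x ≡ nothing → x ∈ Vec.map is-nothing v
  ∈-map-is-nothing⁺ v {x} eq = VecP.lookup⇒[]= x _ (trans (VecP.lookup-map x is-nothing v) (cong is-nothing eq))

  ∈-map-is-nothing⁻ : ∀ (v : Vec (Maybe A) n) {x} → x ∈ Vec.map is-nothing v → lookup v x ≡ nothing
  ∈-map-is-nothing⁻ v {x} x∈ with lookup v x | trans (sym (VecP.lookup-map x is-nothing v)) (VecP.[]=⇒lookup x∈)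
  ... | nothing | _ = refl

module _ {n : ℕ} where

  argmax-Fin : (f : Fin n → ℕ) {P : Fin n → Set} → Decidable P → ∃ P
             → ∃ λ m → P m × (∀ k → P k → f k ≤ f m)
  argmax-Fin f P? (x , px) =
    m , argmax-all f px (AllP.all-filter P? (allFin n)) ,
    λ k pk → All.lookup (f[xs]≤f[argmax] x candidates) (∈-filter⁺ P? (∈-allFin k) pk)
    where
    candidates = filter P? (allFin n)
    m = argmax f x candidates

  argmin-Fin : (f : Fin n → ℕ) {P : Fin n → Set} → Decidable P → ∃ P
             → ∃ λ m → P m × (∀ k → P k → f m ≤ f k)
  argmin-Fin f P? (x , px) =
    m , argmin-all f px (AllP.all-filter P? (allFin n)) ,
    λ k pk → All.lookup (f[argmin]≤f[xs] x candidates) (∈-filter⁺ P? (∈-allFin k) pk)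
    where
    candidates = filter P? (allFin n)
    m = argmin f x candidates

lookup-extensionality : ∀ {A : Set} {n} {u v : Vec A n} → (∀ i → lookup u i ≡ lookup v i) → u ≡ v
lookup-extensionality {u = u} {v} eq =
  trans (sym (VecP.tabulate∘lookup u)) (trans (VecP.tabulate-cong eq) (VecP.tabulate∘lookup v))

module _ {A : Set} where

  ∈-allVecsOver : ∀ (xs : List A) {k} (v : Vec A k) → (∀ i → lookup v i ∈ₗ xs) → v ∈ₗ allVecsOver xs k
  ∈-allVecsOver xs []      _       = here refl
  ∈-allVecsOver xs (x ∷ v) entries =
    ∈-concatMap⁺ (λ y → map (y ∷_) (allVecsOver xs _))
      (Any.map (λ { refl → ∈-map⁺ (x ∷_) (∈-allVecsOver xs v (entries ∘ Fin.suc)) }) (entries Fin.zero))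

  allVecsOver-unique : ∀ {xs : List A} → Unique xs → ∀ k → Unique (allVecsOver xs k)
  allVecsOver-unique _ zero = [] ∷ []
  allVecsOver-unique {xs} xs! (suc k) = prepend-unique xs xs!
    where
    V = allVecsOver xs k
    head∈ : ∀ ys {v} → v ∈ₗ concatMap (λ y → map (y ∷_) V) ys → Vec.head v ∈ₗ ys
    head∈ ys v∈ = Any.map (λ v∈yV → let _ , _ , eq = ∈-map⁻ _ v∈yV in cong Vec.head eq)
                          (∈-concatMap⁻ (λ y → map (y ∷_) V) v∈)
    prepend-unique : ∀ ys → Unique ys → Unique (concatMap (λ y → map (y ∷_) V) ys)
    prepend-unique []       _            = []
    prepend-unique (y ∷ ys) (y∉ys ∷ ys!) =
      UniqueP.++⁺ (UniqueP.map⁺ VecP.∷-injectiveʳ (allVecsOver-unique xs! k)) (prepend-unique ys ys!)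
        λ { (v∈yV , v∈ysV) → let _ , _ , eq = ∈-map⁻ _ v∈yV in
              All.lookup y∉ys (subst (_∈ₗ ys) (cong Vec.head eq) (head∈ ys v∈ysV)) refl }

  Unique-↭ : ∀ {xs ys : List A} → Unique xs → Unique ys
           → (∀ {x} → x ∈ₗ xs → x ∈ₗ ys) → (∀ {x} → x ∈ₗ ys → x ∈ₗ xs) → xs ↭ ys
  Unique-↭ xs! ys! xs⊆ys ys⊆xs = ∼bag⇒↭ (unique∧set⇒bag xs! ys! (mk⇔ xs⊆ys ys⊆xs))

  map-Unique : ∀ {B : Set} {P : A → Set} {R : A → A → Set} (f : A → B)
             → (∀ {x y} → P x → P y → f x ≡ f y → R x y)
             → ∀ {xs} → All P xs → AllPairs (λ x y → ¬ R x y) xs → Unique (map f xs)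
  map-Unique f reflects []         []           = []
  map-Unique f reflects (px ∷ pxs) (¬Rx ∷ ¬Rxs) =
    AllP.map⁺ (All.zipWith (λ (py , ¬Rxy) fx≡fy → ¬Rxy (reflects px py fx≡fy)) (pxs , ¬Rx))
      ∷ map-Unique f reflects pxs ¬Rxs

  module _ {R : A → A → Set} (R? : ∀ x y → Dec (R x y)) where

    deduplicate-AllPairs : ∀ xs → AllPairs (λ x y → ¬ R x y) (deduplicate R? xs)
    deduplicate-AllPairs []       = []
    deduplicate-AllPairs (x ∷ xs) =
      AllP.all-filter (¬? ∘ R? x) (deduplicate R? xs) ∷ AllPairsP.filter⁺ _ (deduplicate-AllPairs xs)

    deduplicate-representative : ∀ {B : Set} (f : A → B) → (∀ {x y} → R x y → f x ≡ f y)
      → ∀ {xs x} → x ∈ₗ xs → ∃ λ y → y ∈ₗ deduplicate R? xs × f y ≡ f x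
    deduplicate-representative f f-resp x∈xs =
      find (AnyP.deduplicate⁺ R? (λ Rxy fy≡ → trans (f-resp Rxy) fy≡) (Any.map (λ { refl → refl }) x∈xs))

monomialSum-↭ : ∀ {ws ws′ : List (ℕ × ℕ)} → ws ↭ ws′ → ∀ a b → monomialSum ws a b ≡ monomialSum ws′ a b
monomialSum-↭ ws↭ws′ a b = PermP.↭-length (PermP.filter-↭ _ ws↭ws′)

minimalRank-vanishes : ∀ {n} (_≼_ : Fin n → Fin n → Set) {ρ} → IsMinimalRankFunction _≼_ ρ → ∃ λ x → ρ x ≡ 0
minimalRank-vanishes {n} _≼_ {ρ} (isRank , minimal) with FinP.any? (λ x → ρ x ℕ.≟ 0)
... | yes found = found
... | no none = ⊥-elim (minimal
  (ℕ.pred ∘ ρ , (λ i j i⋖j → trans (cong ℕ.pred (isRank i j i⋖j)) (suc-pred i)) , suc-pred))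
  where
  suc-pred : ∀ x → ρ x ≡ suc (ℕ.pred (ρ x))
  suc-pred x = sym (ℕP.suc-pred (ρ x) {{ℕ.≢-nonZero (λ ρx≡0 → none (x , ρx≡0))}})

module LinearExtension {n : ℕ} (key : Fin n → ℕ) (key-injective : ∀ {x y} → key x ≡ key y → x ≡ y) where

  private
    smaller : Fin n → Subset n
    smaller x = tabulate (does ∘ λ y → key y ℕ.<? key x)

    ∈-smaller⁺ : ∀ {x y} → key y < key x → y ∈ smaller x
    ∈-smaller⁺ {x} = ∈-tabulate-does⁺ (λ y → key y ℕ.<? key x)

    ∈-smaller⁻ : ∀ {x y} → y ∈ smaller x → key y < key x
    ∈-smaller⁻ {x} = ∈-tabulate-does⁻ (λ y → key y ℕ.<? key x)

    x∉smaller : ∀ x → x ∉ smaller x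
    x∉smaller x x∈ = ℕP.<-irrefl refl (∈-smaller⁻ x∈)

  rank : Fin n → ℕ
  rank x = ∣ smaller x ∣

  rank<n : ∀ x → rank x < n
  rank<n x = subst (rank x <_) (∣⊤∣≡n n) (p⊂q⇒∣p∣<∣q∣ ((λ _ → ∈⊤) , x , ∈⊤ , x∉smaller x))

  rank-mono : ∀ {x y} → key x < key y → rank x < rank y
  rank-mono kx<ky =
    p⊂q⇒∣p∣<∣q∣ ((λ z∈ → ∈-smaller⁺ (ℕP.<-trans (∈-smaller⁻ z∈) kx<ky)) , _ , ∈-smaller⁺ kx<ky , x∉smaller _)

  opaque
    ranking : Ranking n
    ranking = tabulate (λ x → Fin.fromℕ< (rank<n x))

    toℕ-ranking : ∀ x → toℕ (lookup ranking x) ≡ rank x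
    toℕ-ranking x = trans (cong toℕ (VecP.lookup∘tabulate _ x)) (FinP.toℕ-fromℕ< (rank<n x))

  ranking-mono : ∀ {x y} → key x < key y → toℕ (lookup ranking x) < toℕ (lookup ranking y)
  ranking-mono {x} {y} kx<ky = subst₂ _<_ (sym (toℕ-ranking x)) (sym (toℕ-ranking y)) (rank-mono kx<ky)

  ranking-isPerm : IsPerm ranking
  ranking-isPerm x y rx≡ry with ℕP.<-cmp (key x) (key y)
  ... | tri< kx<ky _ _ = ⊥-elim (ℕP.<-irrefl (cong toℕ rx≡ry) (ranking-mono kx<ky))
  ... | tri≈ _ kx≡ky _ = key-injective kx≡ky
  ... | tri> _ _ ky<kx = ⊥-elim (ℕP.<-irrefl (cong toℕ (sym rx≡ry)) (ranking-mono ky<kx))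

module LexicographicRanking {n : ℕ} (major minor : Fin n → ℕ) (minor<n : ∀ x → minor x < n)
                            (minor-injective : ∀ {x y} → minor x ≡ minor y → x ≡ y) where

  key : Fin n → ℕ
  key x = major x * n + minor x

  key-monoˡ : ∀ {x y} → major x < major y → key x < key y
  key-monoˡ {x} {y} mx<my = begin-strict
    major x * n + minor x  <⟨ ℕP.+-monoʳ-< (major x * n) (minor<n x) ⟩
    major x * n + n        ≡⟨ ℕP.+-comm (major x * n) n ⟩
    suc (major x) * n      ≤⟨ ℕP.*-monoˡ-≤ n mx<my ⟩
    major y * n            ≤⟨ ℕP.m≤m+n (major y * n) (minor y) ⟩
    major y * n + minor y  ∎
    where open ℕP.≤-Reasoning

  key-mono : ∀ {x y} → major x ≤ major y → minor x < minor y → key x < key y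
  key-mono mx≤my nx<ny = ℕP.+-mono-≤-< (ℕP.*-monoˡ-≤ n mx≤my) nx<ny

  key-injective : ∀ {x y} → key x ≡ key y → x ≡ y
  key-injective {x} {y} kx≡ky with ℕP.<-cmp (major x) (major y)
  ... | tri< mx<my _ _ = ⊥-elim (ℕP.<-irrefl kx≡ky (key-monoˡ mx<my))
  ... | tri> _ _ my<mx = ⊥-elim (ℕP.<-irrefl (sym kx≡ky) (key-monoˡ my<mx))
  ... | tri≈ _ mx≡my _ =
    minor-injective (ℕP.+-cancelˡ-≡ (major x * n) _ _ (trans kx≡ky (cong (λ m → m * n + minor y) (sym mx≡my))))

  open LinearExtension key key-injective public using (ranking; ranking-isPerm; ranking-mono)

module TreeProperties {n : ℕ} (p : ParentVec n) where
  open Tree p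

  Reaches : Fin n → Fin n → Set
  Reaches x y = ∃ λ k → up k x ≡ just y

  up-+ : ∀ {a x y} → up a x ≡ just y → ∀ b → up (b + a) x ≡ up b y
  up-+ eq zero    = eq
  up-+ eq (suc b) = cong step (up-+ eq b)

  up-+-nothing : ∀ {a x} → up a x ≡ nothing → ∀ b → up (b + a) x ≡ nothing
  up-+-nothing eq zero    = eq
  up-+-nothing eq (suc b) = cong step (up-+-nothing eq b)

  up-parent : ∀ {x q} → lookup p x ≡ just q → ∀ k → up (suc k) x ≡ up k q
  up-parent eq zero    = eq
  up-parent eq (suc k) = cong step (up-parent eq k)

  up-root : ∀ {x} → lookup p x ≡ nothing → ∀ k → up (suc k) x ≡ nothing
  up-root eq zero    = eq
  up-root eq (suc k) = cong step (up-root eq k)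

  reaches-refl : ∀ {x} → Reaches x x
  reaches-refl = 0 , refl

  reaches-trans : ∀ {x y z} → Reaches x y → Reaches y z → Reaches x z
  reaches-trans (a , eq) (b , eq′) = b + a , trans (up-+ eq b) eq′

  reaches-parent : ∀ {x q} → lookup p x ≡ just q → Reaches x q
  reaches-parent eq = 1 , eq

  reaches-via-parent : ∀ {x y q} → Reaches x y → x ≢ y → lookup p x ≡ just q → Reaches q y
  reaches-via-parent (zero  , refl) x≢y _  = ⊥-elim (x≢y refl)
  reaches-via-parent (suc k , eq′)  _   eq = k , trans (sym (up-parent eq k)) eq′

  reaches-from-root : ∀ {x y} → lookup p x ≡ nothing → Reaches x y → x ≡ y
  reaches-from-root _  (zero  , refl) = refl
  reaches-from-root eq (suc k , eq′) with () ← trans (sym (up-root eq k)) eq′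

  reaches-closure : (_∼_ : Fin n → Fin n → Set) → (∀ {x} → x ∼ x) → (∀ {x y z} → x ∼ y → y ∼ z → x ∼ z)
                  → (∀ {x q} → lookup p x ≡ just q → x ∼ q) → ∀ {x y} → Reaches x y → x ∼ y
  reaches-closure _∼_ ∼-refl ∼-trans edge (k , eq) = go k eq
    where
    go : ∀ k {x y} → up k x ≡ just y → x ∼ y
    go zero    refl = ∼-refl
    go (suc k) {x} eq with up k x in eqₖ
    ... | just z = ∼-trans (go k eqₖ) (edge eq)

  up-weight : (w : Fin n → ℕ) → (∀ {x q} → lookup p x ≡ just q → w x < w q)
            → ∀ k {x y} → up k x ≡ just y → k + w x ≤ w y
  up-weight w increasing zero    refl = ℕP.≤-refl
  up-weight w increasing (suc k) {x} eq with up k x in eqₖ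
  ... | just z = ℕP.≤-trans (s≤s (up-weight w increasing k eqₖ)) (increasing eq)

  rooted-if-weighted : (w : Fin n → ℕ) → (∀ x → w x < n) → (∀ {x q} → lookup p x ≡ just q → w x < w q)
                     → ∀ i → up n i ≡ nothing
  rooted-if-weighted w w<n increasing i with up n i in eq
  ... | nothing = refl
  ... | just j  = ⊥-elim (ℕP.<-irrefl refl (begin-strict
    n        ≤⟨ ℕP.m≤m+n n (w i) ⟩
    n + w i  ≤⟨ up-weight w increasing n eq ⟩
    w j      <⟨ w<n j ⟩
    n        ∎))
    where open ℕP.≤-Reasoning

  module Rooted (rooted : ∀ i → up n i ≡ nothing) where

    up-bound : ∀ {k i j} → up k i ≡ just j → k < n
    up-bound {k} {i} eq with ℕP.<-≤-connex k n
    ... | inj₁ k<n = k<n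
    ... | inj₂ n≤k with () ← trans (sym (up-+-nothing (rooted i) (k ∸ n)))
                                  (subst (λ m → up m i ≡ just _) (sym (ℕP.m∸n+n≡m n≤k)) eq)

    no-cycle : ∀ {k x} → up (suc k) x ≢ just x
    no-cycle {k} {x} eq =
      ℕP.<-irrefl refl (ℕP.<-≤-trans (up-bound {n * suc k} {x} {x} (iterate n)) (ℕP.m≤m*n n (suc k)))
      where
      iterate : ∀ m → up (m * suc k) x ≡ just x
      iterate zero    = refl
      iterate (suc m) = trans (up-+ (iterate m) (suc k)) eq

    parent-irreflexive : ∀ {x} → lookup p x ≢ just x
    parent-irreflexive = no-cycle {0}

    reaches-antisym : ∀ {x y} → Reaches x y → Reaches y x → x ≡ y
    reaches-antisym (zero  , refl) _ = refl
    reaches-antisym {x} (suc a , eq) (b , eq′) =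
      ⊥-elim (no-cycle {b + a} (trans (cong (λ m → up m x) (sym (ℕP.+-suc b a))) (trans (up-+ eq b) eq′)))

    Below⇒Reaches : ∀ {j i} → Below j i → Reaches j i
    Below⇒Reaches (k , eq) = toℕ k , eq

    Reaches⇒Below : ∀ {j i} → Reaches j i → Below j i
    Reaches⇒Below {j} {i} (k , eq) =
      Fin.fromℕ< k<n , subst (λ m → up m j ≡ just i) (sym (FinP.toℕ-fromℕ< k<n)) eq
      where k<n = up-bound {k} {j} {i} eq

    ∈T≤⁺ : ∀ {j i} → Reaches j i → j ∈ T≤ i
    ∈T≤⁺ {i = i} = ∈-tabulate-does⁺ (λ j → below? j i) ∘ Reaches⇒Below

    ∈T≤⁻ : ∀ {j i} → j ∈ T≤ i → Reaches j i
    ∈T≤⁻ {i = i} = Below⇒Reaches ∘ ∈-tabulate-does⁻ (λ j → below? j i)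

    ancestors : Fin n → Subset n
    ancestors x = tabulate (does ∘ λ i → ¬? (i Fin.≟ x) ×-dec below? x i)

    ∈ancestors⁺ : ∀ {x i} → i ≢ x → Reaches x i → i ∈ ancestors x
    ∈ancestors⁺ {x} i≢x x→i = ∈-tabulate-does⁺ (λ i → ¬? (i Fin.≟ x) ×-dec below? x i) (i≢x , Reaches⇒Below x→i)

    ∈ancestors⁻ : ∀ {x i} → i ∈ ancestors x → i ≢ x × Reaches x i
    ∈ancestors⁻ {x} i∈ = let i≢x , x→i = ∈-tabulate-does⁻ (λ i → ¬? (i Fin.≟ x) ×-dec below? x i) i∈
                         in i≢x , Below⇒Reaches x→i

    ancestors-parent : ∀ {x q} → lookup p x ≡ just q → ancestors x ≡ ⁅ q ⁆ ∪ ancestors q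
    ancestors-parent {x} {q} eq = ⊆-antisym ⊆-step ⊇-step
      where
      q≢x : q ≢ x
      q≢x q≡x = parent-irreflexive (subst (λ z → lookup p x ≡ just z) q≡x eq)
      ⊆-step : ancestors x ⊆ ⁅ q ⁆ ∪ ancestors q
      ⊆-step {i} i∈ with i Fin.≟ q | ∈ancestors⁻ i∈
      ... | yes refl | _ = x∈p∪q⁺ (inj₁ (x∈⁅x⁆ q))
      ... | no i≢q | i≢x , x→i = x∈p∪q⁺ (inj₂ (∈ancestors⁺ i≢q (reaches-via-parent x→i (i≢x ∘ sym) eq)))
      ⊇-step : ⁅ q ⁆ ∪ ancestors q ⊆ ancestors x
      ⊇-step {i} i∈ with x∈p∪q⁻ ⁅ q ⁆ (ancestors q) i∈
      ... | inj₁ i∈⁅q⁆ rewrite x∈⁅y⁆⇒x≡y q i∈⁅q⁆ = ∈ancestors⁺ q≢x (reaches-parent eq)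
      ... | inj₂ i∈ancq =
        let i≢q , q→i = ∈ancestors⁻ i∈ancq
            x→i = reaches-trans (reaches-parent eq) q→i
        in ∈ancestors⁺ (λ { refl → q≢x (reaches-antisym q→i (reaches-parent eq)) }) x→i

    dp-parent : ∀ {x q} → lookup p x ≡ just q → dp x ≡ suc (dp q)
    dp-parent {x} {q} eq = trans (cong ∣_∣ (ancestors-parent eq))
                                 (∣⁅x⁆∪p∣≡1+∣p∣ (λ q∈ → proj₁ (∈ancestors⁻ q∈) refl))

    dp-root : ∀ {x} → lookup p x ≡ nothing → dp x ≡ 0
    dp-root {x} eq = trans (cong ∣_∣ (Empty-unique no-ancestor)) (∣⊥∣≡0 n)
      where
      no-ancestor : Empty (ancestors x)
      no-ancestor (i , i∈) = let i≢x , x→i = ∈ancestors⁻ i∈ in i≢x (sym (reaches-from-root eq x→i))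

    depth≡ : ∀ {C} → (∀ x → dp x ≤ C) → ∀ x₀ → dp x₀ ≡ C → depth ≡ C
    depth≡ {C} bounded x₀ dp≡C = ℕP.≤-antisym
      (ListP.foldr-preservesᵇ {P = _≤ C} ℕP.⊔-lub z≤n (AllP.map⁺ (AllP.tabulate⁺ bounded)))
      (subst (_≤ depth) dp≡C (ListP.foldr-preservesᵒ {P = dp x₀ ≤_}
          (λ a b → [ ℕP.m≤n⇒m≤n⊔o b , ℕP.m≤n⇒m≤o⊔n a ]′) 0
          (map dp (allFin n)) (inj₂ (AnyP.map⁺ (Any.map (λ { refl → ℕP.≤-refl }) (∈-allFin x₀))))))

    grading≡depth∸dp : (f : Fin n → ℕ) → (∀ {x q} → lookup p x ≡ just q → f q ≡ suc (f x))
                     → ∀ {root} → lookup p root ≡ nothing → (∀ x → Reaches x root)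
                     → (∃ λ x → f x ≡ 0) → ∀ x → f x ≡ depth ∸ dp x
    grading≡depth∸dp f f-parent {root} root-isRoot reach (x₀ , f[x₀]≡0) x = begin
      f x                  ≡⟨ ℕP.m+n∸n≡m (f x) (dp x) ⟨
      (f x + dp x) ∸ dp x  ≡⟨ cong (_∸ dp x) (f+dp≡f[root] (reach x)) ⟩
      f root ∸ dp x        ≡⟨ cong (_∸ dp x) depth≡f[root] ⟨
      depth ∸ dp x         ∎
      where
      open ≡-Reasoning
      f+dp≡f[root] : ∀ {x} → Reaches x root → f x + dp x ≡ f root
      f+dp≡f[root] (k , eq) = along k eq
        where
        along : ∀ k {x} → up k x ≡ just root → f x + dp x ≡ f root
        along zero    refl = trans (cong (f root +_) (dp-root root-isRoot)) (ℕP.+-identityʳ _)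
        along (suc k) {x} eq with lookup p x in eqₓ
        ... | nothing with () ← trans (sym (up-root eqₓ k)) eq
        ... | just q = begin
          f x + dp x        ≡⟨ cong (f x +_) (dp-parent eqₓ) ⟩
          f x + suc (dp q)  ≡⟨ ℕP.+-suc (f x) (dp q) ⟩
          suc (f x) + dp q  ≡⟨ cong (_+ dp q) (f-parent eqₓ) ⟨
          f q + dp q        ≡⟨ along k (trans (sym (up-parent eqₓ k)) eq) ⟩
          f root            ∎

      depth≡f[root] : depth ≡ f root
      depth≡f[root] = depth≡
        (λ y → ℕP.≤-trans (ℕP.m≤n+m (dp y) (f y)) (ℕP.≤-reflexive (f+dp≡f[root] (reach y))))
        x₀ (trans (cong (_+ dp x₀) (sym f[x₀]≡0)) (f+dp≡f[root] (reach x₀)))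

module NormalFan {n : ℕ} (B : Pred (Subset n) 0ℓ) (B? : Decidable B) (isB : IsBuildingSet B) where
  open IsBuildingSet isB
  open Nesto B B?
  open BTrees B B?

  foldr-∪-closed : ∀ {A} Ls → B A → All (λ L → B L × Nonempty (L ∩ A)) Ls → B (foldr _∪_ A Ls)
  foldr-∪-closed         []       B[A] []                          = B[A]
  foldr-∪-closed {A = A} (L ∷ Ls) B[A] ((B[L] , x , x∈L∩A) ∷ rest) =
    union-closed L (foldr _∪_ A Ls) B[L] (foldr-∪-closed Ls B[A] rest)
      (x , x∈p∩q⁺ (proj₁ (x∈p∩q⁻ L A x∈L∩A) , ∈-foldr-∪⁺ˡ A Ls (proj₂ (x∈p∩q⁻ L A x∈L∩A))))

  allSubsets : List (Subset n)
  allSubsets = allVecsOver (inside ∷ outside ∷ []) n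

  ∈-allSubsets : ∀ S → S ∈ₗ allSubsets
  ∈-allSubsets S = ∈-allVecsOver _ S (λ i → side∈ (lookup S i))
    where
    side∈ : ∀ s → s ∈ₗ inside ∷ outside ∷ []
    side∈ inside  = here refl
    side∈ outside = there (here refl)

  module _ (p : ParentVec n) where
    open Tree p

    ∈-unionBelow⁻ : ∀ {S x} → x ∈ unionBelow p S → ∃ λ s → s ∈ S × x ∈ T≤ s
    ∈-unionBelow⁻ {S} x∈ with ∈-⋃⁻ (map T≤ (filter (_∈? S) (allFin n))) x∈
    ... | L , L∈ , x∈L with ∈-map⁻ T≤ L∈
    ...   | s , s∈ , refl = s , proj₂ (∈-filter⁻ (_∈? S) {xs = allFin n} s∈) , x∈L

    ∈-unionBelow⁺ : ∀ {S x s} → s ∈ S → x ∈ T≤ s → x ∈ unionBelow p S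
    ∈-unionBelow⁺ {S} {s = s} s∈S =
      ∈-⋃⁺ (map T≤ (filter (_∈? S) (allFin n))) (∈-map⁺ T≤ (∈-filter⁺ (_∈? S) (∈-allFin s) s∈S))

  ∈-perms : ∀ r → IsPerm r → r ∈ₗ perms n
  ∈-perms r r-isPerm = ∈-filter⁺ isPerm? (∈-allVecsOver (allFin n) _ (λ i → ∈-allFin _)) r-isPerm

  perms-isPerm : ∀ {r} → r ∈ₗ perms n → IsPerm r
  perms-isPerm r∈ = proj₂ (∈-filter⁻ isPerm? {xs = allVecsOver (allFin n) n} r∈)

  IsMax-unique : ∀ r → IsPerm r → ∀ {I a b} → IsMax r I a → IsMax r I b → a ≡ b
  IsMax-unique r r-isPerm (a∈I , a-max) (b∈I , b-max) =
    r-isPerm _ _ (FinP.toℕ-injective (ℕP.≤-antisym (b-max _ a∈I) (a-max _ b∈I)))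

  module Blocks (r : Ranking n) where

    R : Fin n → ℕ
    R x = toℕ (lookup r x)

    Crowned : Fin n → Subset n → Set
    Crowned i I = B I × IsMax r I i

    crowned? : ∀ i I → Dec (Crowned i I)
    crowned? i I = B? I ×-dec isMax? r I i

    crownedSets : Fin n → List (Subset n)
    crownedSets i = filter (crowned? i) allSubsets

    opaque
      block : Fin n → Subset n
      block i = foldr _∪_ ⁅ i ⁆ (crownedSets i)

      i∈block : ∀ i → i ∈ block i
      i∈block i = ∈-foldr-∪⁺ˡ ⁅ i ⁆ (crownedSets i) (x∈⁅x⁆ i)

      block∈B : ∀ i → B (block i)
      block∈B i = foldr-∪-closed (crownedSets i) (singletons i) (All.tabulate λ I∈ →
        let B[I] , i∈I , _ = proj₂ (∈-filter⁻ (crowned? i) {xs = allSubsets} I∈)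
        in B[I] , i , x∈p∩q⁺ (i∈I , x∈⁅x⁆ i))

      block-bound : ∀ {i j} → j ∈ block i → R j ≤ R i
      block-bound {i} {j} j∈ with ∈-foldr-∪⁻ ⁅ i ⁆ (crownedSets i) j∈
      ... | inj₁ j∈⁅i⁆ = ℕP.≤-reflexive (cong R (x∈⁅y⁆⇒x≡y i j∈⁅i⁆))
      ... | inj₂ (I , I∈ , j∈I) = proj₂ (proj₂ (proj₂ (∈-filter⁻ (crowned? i) {xs = allSubsets} I∈))) j j∈I

      block-greatest : ∀ {i I} → Crowned i I → I ⊆ block i
      block-greatest {i} {I} crowned = ∈-foldr-∪⁺ʳ ⁅ i ⁆ (crownedSets i) (∈-filter⁺ (crowned? i) (∈-allSubsets I) crowned)

    block-crowned : ∀ i → Crowned i (block i)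
    block-crowned i = block∈B i , i∈block i , λ _ → block-bound

    block-merge : ∀ {a b} → Nonempty (block a ∩ block b) → R a ≤ R b → block a ⊆ block b
    block-merge {a} {b} meet Ra≤Rb x∈a = block-greatest crowned (x∈p∪q⁺ (inj₁ x∈a))
      where
      crowned : Crowned b (block a ∪ block b)
      crowned = union-closed _ _ (block∈B a) (block∈B b) meet , x∈p∪q⁺ (inj₂ (i∈block b)) ,
                λ k k∈ → [ (λ k∈a → ℕP.≤-trans (block-bound k∈a) Ra≤Rb) , block-bound ]′ (x∈p∪q⁻ _ _ k∈)

    block-trans : ∀ {x y z} → x ∈ block y → y ∈ block z → x ∈ block z
    block-trans {y = y} x∈y y∈z = block-merge (y , x∈p∩q⁺ (i∈block y , y∈z)) (block-bound y∈z) x∈y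

    block-nested : ∀ {x a b} → x ∈ block a → x ∈ block b → R a ≤ R b → a ∈ block b
    block-nested {x} {a} x∈a x∈b Ra≤Rb = block-merge (x , x∈p∩q⁺ (x∈a , x∈b)) Ra≤Rb (i∈block a)

    module _ (r-isPerm : IsPerm r) where

      R-injective : ∀ {a b} → R a ≡ R b → a ≡ b
      R-injective eq = r-isPerm _ _ (FinP.toℕ-injective eq)

      block-antisym : ∀ {a b} → a ∈ block b → b ∈ block a → a ≡ b
      block-antisym a∈b b∈a = R-injective (ℕP.≤-antisym (block-bound a∈b) (block-bound b∈a))

      block-strict : ∀ {a b} → a ∈ block b → a ≢ b → R a < R b
      block-strict a∈b a≢b = ℕP.≤∧≢⇒< (block-bound a∈b) (a≢b ∘ R-injective)

  open Blocks

  sameCone-sym : ∀ {r r′} → SameCone r r′ → SameCone r′ r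
  sameCone-sym same I B[I] m = proj₂ (same I B[I] m) , proj₁ (same I B[I] m)

  sameCone⇒block⊆ : ∀ {r r′} → SameCone r r′ → ∀ i → block r i ⊆ block r′ i
  sameCone⇒block⊆ {r} {r′} same i = block-greatest r′
    (block∈B r i , proj₁ (same (block r i) (block∈B r i) i) (proj₂ (block-crowned r i)))

  sameCone⇒sameBlocks : ∀ {r r′} → SameCone r r′ → ∀ i → block r i ≡ block r′ i
  sameCone⇒sameBlocks {r} {r′} same i =
    ⊆-antisym (sameCone⇒block⊆ {r} {r′} same i) (sameCone⇒block⊆ {r′} {r} (sameCone-sym {r} {r′} same) i)

  sameBlocks⇒sameCone : ∀ {r r′} → (∀ i → block r i ≡ block r′ i) → SameCone r r′
  sameBlocks⇒sameCone {r} {r′} same I B[I] m = max⇒max {r} {r′} same , max⇒max {r′} {r} (sym ∘ same)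
    where
    max⇒max : ∀ {r r′} → (∀ i → block r i ≡ block r′ i) → IsMax r I m → IsMax r′ I m
    max⇒max {r} {r′} same (m∈I , m-max) =
      m∈I , λ k k∈I → block-bound r′ (subst (k ∈_) (same m) (block-greatest r (B[I] , m∈I , m-max) k∈I))

  module ParentOf (r : Ranking n) where

    Candidate : Fin n → Fin n → Set
    Candidate x j = j ≢ x × x ∈ block r j

    candidate? : ∀ x j → Dec (Candidate x j)
    candidate? x j = ¬? (j Fin.≟ x) ×-dec (x ∈? block r j)

    data ParentSpec (x : Fin n) : Maybe (Fin n) → Set where
      root   : (∀ j → ¬ Candidate x j) → ParentSpec x nothing
      parent : ∀ {q} → Candidate x q → (∀ j → Candidate x j → R r q ≤ R r j) → ParentSpec x (just q)

    parentOf : Fin n → Maybe (Fin n)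
    parentOf x with FinP.any? (candidate? x)
    ... | yes some = just (proj₁ (argmin-Fin (R r) (candidate? x) some))
    ... | no _     = nothing

    parentOf-spec : ∀ x → ParentSpec x (parentOf x)
    parentOf-spec x with FinP.any? (candidate? x)
    ... | yes some = let _ , cq , least = argmin-Fin (R r) (candidate? x) some in parent cq least
    ... | no none  = root (λ j cj → none (j , cj))

  open ParentOf

  treeOf : Ranking n → ParentVec n
  treeOf r = tabulate (parentOf r)

  treeOf-spec : ∀ r {x m} → lookup (treeOf r) x ≡ m → ParentSpec r x m
  treeOf-spec r {x} refl = subst (ParentSpec r x) (sym (VecP.lookup∘tabulate (parentOf r) x)) (parentOf-spec r x)

  module TreeOfPermutation (r : Ranking n) (r-isPerm : IsPerm r) where
    open Tree (treeOf r)
    open TreeProperties (treeOf r)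

    parent-candidate : ∀ {x q} → lookup (treeOf r) x ≡ just q → Candidate r x q
    parent-candidate eq with treeOf-spec r eq
    ... | parent cq _ = cq

    parent-least : ∀ {x q j} → lookup (treeOf r) x ≡ just q → Candidate r x j → R r q ≤ R r j
    parent-least eq cj with treeOf-spec r eq
    ... | parent _ least = least _ cj

    parent∈block : ∀ {x q j} → lookup (treeOf r) x ≡ just q → Candidate r x j → q ∈ block r j
    parent∈block eq cj = block-nested r (proj₂ (parent-candidate eq)) (proj₂ cj) (parent-least eq cj)

    root-no-candidate : ∀ {x j} → lookup (treeOf r) x ≡ nothing → ¬ Candidate r x j
    root-no-candidate eq cj with treeOf-spec r eq
    ... | root none = none _ cj

    parent-if-least : ∀ {x q} → Candidate r x q → (∀ j → Candidate r x j → q ∈ block r j)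
                  → lookup (treeOf r) x ≡ just q
    parent-if-least {x} cq q-least with lookup (treeOf r) x in eq
    ... | nothing = ⊥-elim (root-no-candidate eq cq)
    ... | just q′ = cong just (block-antisym r r-isPerm (parent∈block eq cq) (q-least q′ (parent-candidate eq)))

    root-if-no-candidate : ∀ {x} → (∀ j → ¬ Candidate r x j) → lookup (treeOf r) x ≡ nothing
    root-if-no-candidate {x} none with lookup (treeOf r) x in eq
    ... | nothing = refl
    ... | just q  = ⊥-elim (none q (parent-candidate eq))

    parent-increasing : ∀ {x q} → lookup (treeOf r) x ≡ just q → R r x < R r q
    parent-increasing eq = let q≢x , x∈q = parent-candidate eq in block-strict r r-isPerm x∈q (q≢x ∘ sym)

    rooted : ∀ i → up n i ≡ nothing
    rooted = rooted-if-weighted (R r) (λ x → FinP.toℕ<n (lookup r x)) parent-increasing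

    open Rooted rooted

    reaches⇒block : ∀ {x y} → Reaches x y → x ∈ block r y
    reaches⇒block = reaches-closure (λ x y → x ∈ block r y) (i∈block r _) (block-trans r) (proj₂ ∘ parent-candidate)

    block⇒reaches : ∀ {x y} → x ∈ block r y → Reaches x y
    block⇒reaches {x} {y} = go (suc (R r y ∸ R r x)) ℕP.≤-refl
      where
      go : ∀ bound {x} → R r y ∸ R r x < bound → x ∈ block r y → Reaches x y
      go (suc bound) {x} gap x∈y with x Fin.≟ y | lookup (treeOf r) x in eq
      ... | yes refl | _       = reaches-refl
      ... | no x≢y   | nothing = ⊥-elim (root-no-candidate eq ((x≢y ∘ sym) , x∈y))
      ... | no x≢y   | just q  = reaches-trans (reaches-parent eq) (go bound gap′ q∈y)
        where
        q∈y = parent∈block eq ((x≢y ∘ sym) , x∈y)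
        gap′ = ℕP.<-≤-trans (ℕP.∸-monoʳ-< (parent-increasing eq) (block-bound r q∈y)) (ℕP.≤-pred gap)

    T≤≡block : ∀ i → T≤ i ≡ block r i
    T≤≡block i = ⊆-antisym (reaches⇒block ∘ ∈T≤⁻) (∈T≤⁺ ∘ block⇒reaches)

    incomparable-union∉B : ∀ S → 2 ≤ ∣ S ∣ → (∀ i j → i ∈ S → j ∈ S → i ≢ j → Incomparable i j)
                         → ¬ B (unionBelow (treeOf r) S)
    -- the r-maximum of the union is some s ∈ S, so the union is crowned by s and lies below s
    incomparable-union∉B S 2≤∣S∣ incomparable B[union] =
      let s₀ , s₀∈S      = 0<∣p∣⇒Nonempty S (ℕP.≤-trans (s≤s z≤n) 2≤∣S∣)
          m , m∈union , m-max = argmax-Fin (R r) (_∈? union) (s₀ , member s₀∈S)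
          s , s∈S , m∈s   = ∈-unionBelow⁻ (treeOf r) m∈union
          m≡s = R-injective r r-isPerm (ℕP.≤-antisym (block-bound r (reaches⇒block (∈T≤⁻ m∈s))) (m-max s (member s∈S)))
          union⊆block[s] = block-greatest r
            (B[union] , member s∈S , λ k k∈union → subst (λ z → R r k ≤ R r z) m≡s (m-max k k∈union))
          s′ , s′∈S , s′≢s = another-element S 2≤∣S∣ s∈S
      in proj₁ (incomparable s′ s s′∈S s∈S s′≢s) (Reaches⇒Below (block⇒reaches (union⊆block[s] (member s′∈S))))
      where
      union = unionBelow (treeOf r) S
      member : ∀ {s} → s ∈ S → s ∈ union
      member s∈S = ∈-unionBelow⁺ (treeOf r) s∈S (∈T≤⁺ reaches-refl)

    module WithRoot (conn : IsConnected B) where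

      top : Fin n
      top = proj₁ (argmax-Fin (R r) (_∈? ⊤) (members-nonempty ⊤ conn))

      top-crowned : Crowned r top ⊤
      top-crowned = conn , proj₂ (argmax-Fin (R r) (_∈? ⊤) (members-nonempty ⊤ conn))

      ∈block[top] : ∀ x → x ∈ block r top
      ∈block[top] x = block-greatest r top-crowned ∈⊤

      top-isRoot : lookup (treeOf r) top ≡ nothing
      top-isRoot = root-if-no-candidate λ j (j≢top , top∈j) → j≢top (block-antisym r r-isPerm (∈block[top] j) top∈j)

      only-root : ∀ {x} → lookup (treeOf r) x ≡ nothing → x ≡ top
      only-root {x} eq with x Fin.≟ top
      ... | yes x≡top = x≡top
      ... | no x≢top  = ⊥-elim (root-no-candidate eq ((x≢top ∘ sym) , ∈block[top] x))

      reaches-top : ∀ x → Reaches x top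
      reaches-top x = block⇒reaches (∈block[top] x)

      isBTree : IsBTree (treeOf r)
      isBTree = ( only-element⇒∣p∣≡1 (∈-map-is-nothing⁺ (treeOf r) top-isRoot) (only-root ∘ ∈-map-is-nothing⁻ (treeOf r))
                , rooted )
              , (λ i → subst B (sym (T≤≡block i)) (block∈B r i))
              , incomparable-union∉B

  module PosetOfCone (r : Ranking n) (r-isPerm : IsPerm r) where
    open Tree (treeOf r)
    open TreeProperties (treeOf r)
    open TreeOfPermutation r r-isPerm

    _≼_ : Fin n → Fin n → Set
    i ≼ j = i ≤Q[ r ] j

    block⇒≼ : ∀ {i j} → i ∈ block r j → i ≼ j
    block⇒≼ {i} {j} i∈j = All.tabulate λ {r′} _ same →
      block-bound r′ (subst (i ∈_) (sameCone⇒sameBlocks {r} {r′} (sameCone-sym {r′} {r} same) j) i∈j)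

    module Raised (j : Fin n) where

      level : Fin n → ℕ
      level x with x ∈? block r j
      ... | yes _ = 0
      ... | no _  = 1

      level-mono : ∀ {x y} → (y ∈ block r j → x ∈ block r j) → level x ≤ level y
      level-mono {x} {y} y∈⇒x∈ with x ∈? block r j | y ∈? block r j
      ... | yes _  | _      = z≤n
      ... | no _   | no _   = ℕP.≤-refl
      ... | no x∉  | yes y∈ = ⊥-elim (x∉ (y∈⇒x∈ y∈))

      level-< : ∀ {x y} → x ∈ block r j → y ∉ block r j → level x < level y
      level-< {x} {y} x∈ y∉ with x ∈? block r j | y ∈? block r j
      ... | yes _ | no _   = s≤s z≤n
      ... | no x∉ | _      = ⊥-elim (x∉ x∈)
      ... | _     | yes y∈ = ⊥-elim (y∉ y∈)

      open LexicographicRanking level (R r) (λ x → FinP.toℕ<n (lookup r x)) (R-injective r r-isPerm) public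

      raised-preserves-max : ∀ {I m} → B I → IsMax r I m → IsMax ranking I m
      raised-preserves-max {I} {m} B[I] (m∈I , m-max) = m∈I , below-m
        where
        below-m : ∀ k → k ∈ I → toℕ (lookup ranking k) ≤ toℕ (lookup ranking m)
        below-m k k∈I with k Fin.≟ m
        ... | yes refl = ℕP.≤-refl
        ... | no k≢m   = ℕP.<⇒≤ (ranking-mono (key-mono
              (level-mono (block-trans r (block-greatest r (B[I] , m∈I , m-max) k∈I)))
              (ℕP.≤∧≢⇒< (m-max k k∈I) (k≢m ∘ R-injective r r-isPerm))))

      raised-sameCone : SameCone ranking r
      raised-sameCone I B[I] m = max⇒max , raised-preserves-max B[I]
        where
        max⇒max : IsMax ranking I m → IsMax r I m
        max⇒max m-max′ =
          let m₀ , m₀∈I , m₀-max = argmax-Fin (R r) (_∈? I) (m , proj₁ m-max′)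
          in subst (IsMax r I) (IsMax-unique ranking ranking-isPerm (raised-preserves-max B[I] (m₀∈I , m₀-max)) m-max′)
                   (m₀∈I , m₀-max)

      raised-outside : ∀ {i} → i ∉ block r j → toℕ (lookup ranking j) < toℕ (lookup ranking i)
      raised-outside i∉ = ranking-mono (key-monoˡ (level-< (i∈block r j) i∉))

    ≼⇒block : ∀ {i j} → i ≼ j → i ∈ block r j
    ≼⇒block {i} {j} i≼j with i ∈? block r j
    ... | yes i∈j = i∈j
    ... | no  i∉j =
      ⊥-elim (ℕP.<⇒≱ (raised-outside i∉j) (All.lookup i≼j (∈-perms ranking ranking-isPerm) raised-sameCone))
      where open Raised j

    covers⇒parent : ∀ {i j} → Covers _≼_ i j → lookup (treeOf r) i ≡ just j
    covers⇒parent {i} {j} ((i≼j , i≢j) , nothing-between) with lookup (treeOf r) i in eq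
    ... | nothing = ⊥-elim (root-no-candidate eq ((i≢j ∘ sym) , ≼⇒block i≼j))
    ... | just q with q Fin.≟ j
    ...   | yes refl = refl
    ...   | no q≢j   = ⊥-elim (nothing-between q
              ((block⇒≼ i∈q , (q≢i ∘ sym)) , (block⇒≼ (parent∈block eq ((i≢j ∘ sym) , ≼⇒block i≼j)) , q≢j)))
      where
      q≢i = proj₁ (parent-candidate eq)
      i∈q = proj₂ (parent-candidate eq)

    parent⇒covers : ∀ {i j} → lookup (treeOf r) i ≡ just j → Covers _≼_ i j
    parent⇒covers {i} {j} eq = (block⇒≼ i∈j , (j≢i ∘ sym)) , nothing-between
      where
      j≢i = proj₁ (parent-candidate eq)
      i∈j = proj₂ (parent-candidate eq)
      nothing-between : ∀ k → ¬ (((i ≼ k) × (i ≢ k)) × ((k ≼ j) × (k ≢ j)))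
      nothing-between k ((i≼k , i≢k) , (k≼j , k≢j)) = k≢j (R-injective r r-isPerm
        (ℕP.≤-antisym (block-bound r (≼⇒block k≼j)) (parent-least eq ((i≢k ∘ sym) , ≼⇒block i≼k))))

    DesPoset≡DesTree : DesPoset _≼_ (≤Q? r) ≡ DesTree
    DesPoset≡DesTree = ListP.filter-≐ _ _
      ((λ (i⋖j , j<i) → covers⇒parent i⋖j , j<i) , (λ (eq , j<i) → parent⇒covers eq , j<i))
      (cartesianProduct (allFin n) (allFin n))

    desPoset≡desTree : desPoset _≼_ (≤Q? r) ≡ desTree
    desPoset≡desTree = cong List.length DesPoset≡DesTree

    majPoset≡majTree : IsConnected B → ∀ {ρ} → IsMinimalRankFunction _≼_ ρ → majPoset _≼_ (≤Q? r) ρ ≡ majTree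
    majPoset≡majTree conn {ρ} ρ-minimal = cong sum (begin
      map (ρ ∘ proj₂) (DesPoset _≼_ (≤Q? r))  ≡⟨ cong (map (ρ ∘ proj₂)) DesPoset≡DesTree ⟩
      map (ρ ∘ proj₂) DesTree                 ≡⟨ ListP.map-cong (ρ≡depth∸dp ∘ proj₂) DesTree ⟩
      map (λ q → depth ∸ dp (proj₂ q)) DesTree ∎)
      where
      open ≡-Reasoning
      open WithRoot conn
      open Rooted rooted
      ρ≡depth∸dp : ∀ x → ρ x ≡ depth ∸ dp x
      ρ≡depth∸dp = grading≡depth∸dp ρ (λ eq → proj₁ ρ-minimal _ _ (parent⇒covers eq)) top-isRoot reaches-top
                                      (minimalRank-vanishes _≼_ ρ-minimal)

  module RankingOfBTree (p : ParentVec n) (p-isBTree : IsBTree p) where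
    open Tree p
    open TreeProperties p
    open Rooted (proj₂ (proj₁ p-isBTree))

    ∣T≤∣-increasing : ∀ {x q} → lookup p x ≡ just q → ∣ T≤ x ∣ < ∣ T≤ q ∣
    ∣T≤∣-increasing {x} {q} eq = p⊂q⇒∣p∣<∣q∣
      ( (λ y∈ → ∈T≤⁺ (reaches-trans (∈T≤⁻ y∈) (reaches-parent eq))) , q , ∈T≤⁺ reaches-refl
      , λ q∈x → parent-irreflexive (subst (λ z → lookup p x ≡ just z) (reaches-antisym (∈T≤⁻ q∈x) (reaches-parent eq)) eq))

    open LexicographicRanking (λ x → ∣ T≤ x ∣) toℕ FinP.toℕ<n FinP.toℕ-injective public

    R-increasing : ∀ {x q} → lookup p x ≡ just q → R ranking x < R ranking q
    R-increasing eq = ranking-mono (key-monoˡ (∣T≤∣-increasing eq))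

    reaches⇒R≤ : ∀ {x y} → Reaches x y → R ranking x ≤ R ranking y
    reaches⇒R≤ = reaches-closure (λ x y → R ranking x ≤ R ranking y) ℕP.≤-refl ℕP.≤-trans (ℕP.<⇒≤ ∘ R-increasing)

    T≤⊆block : ∀ i → T≤ i ⊆ block ranking i
    T≤⊆block i = block-greatest ranking (proj₁ (proj₂ p-isBTree) i , ∈T≤⁺ reaches-refl , λ k k∈ → reaches⇒R≤ (∈T≤⁻ k∈))

    -- every member of block ranking i lies below a maximal one (a "top"); the tops are pairwise
    -- incomparable and the union of their subtrees is in B, so i is the only top
    module Tops (i : Fin n) where

      IsTop : Fin n → Set
      IsTop s = s ∈ block ranking i × (∀ a → a ∈ block ranking i → Below s a → a ≡ s)

      isTop? : ∀ s → Dec (IsTop s)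
      isTop? s = (s ∈? block ranking i)
        ×-dec FinP.all? (λ a → (a ∈? block ranking i) →-dec (below? s a →-dec (a Fin.≟ s)))

      tops : Subset n
      tops = tabulate (does ∘ isTop?)

      top-above : ∀ {x} → x ∈ block ranking i → ∃ λ s → s ∈ tops × Reaches x s
      top-above {x} x∈ =
        let s , (s∈ , x→s) , s-max = argmax-Fin (R ranking) (λ a → (a ∈? block ranking i) ×-dec below? x a)
                                                (x , x∈ , Reaches⇒Below reaches-refl)
            s-top : IsTop s
            s-top = s∈ , λ a a∈ s→a → R-injective ranking ranking-isPerm (ℕP.≤-antisym
                      (s-max a (a∈ , Reaches⇒Below (reaches-trans (Below⇒Reaches x→s) (Below⇒Reaches s→a))))
                      (reaches⇒R≤ (Below⇒Reaches s→a)))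
        in s , ∈-tabulate-does⁺ isTop? s-top , Below⇒Reaches x→s

      i-isTop : i ∈ tops
      i-isTop = ∈-tabulate-does⁺ isTop? (i∈block ranking i , λ a a∈ i→a → R-injective ranking ranking-isPerm
                  (ℕP.≤-antisym (block-bound ranking a∈) (reaches⇒R≤ (Below⇒Reaches i→a))))

      tops-incomparable : ∀ a b → a ∈ tops → b ∈ tops → a ≢ b → Incomparable a b
      tops-incomparable a b a∈ b∈ a≢b =
          (λ a→b → a≢b (sym (proj₂ (top a∈) b (proj₁ (top b∈)) a→b)))
        , (λ b→a → a≢b (proj₂ (top b∈) a (proj₁ (top a∈)) b→a))
        where top = ∈-tabulate-does⁻ isTop?

      unionBelow-tops∈B : B (unionBelow p tops)
      unionBelow-tops∈B =
        subst B (foldr-∪-absorbed {S = block ranking i} subtrees block⊆⋃)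
                (foldr-∪-closed subtrees (block∈B ranking i) (All.tabulate meets))
        where
        subtrees = map T≤ (filter (_∈? tops) (allFin n))
        block⊆⋃ : block ranking i ⊆ ⋃ subtrees
        block⊆⋃ x∈ = let s , s∈ , x→s = top-above x∈ in ∈-unionBelow⁺ p s∈ (∈T≤⁺ x→s)
        meets : ∀ {L} → L ∈ₗ subtrees → B L × Nonempty (L ∩ block ranking i)
        meets L∈ with ∈-map⁻ T≤ L∈
        ... | s , s∈ , refl =
          let s∈tops = proj₂ (∈-filter⁻ (_∈? tops) {xs = allFin n} s∈)
          in proj₁ (proj₂ p-isBTree) s , s , x∈p∩q⁺ (∈T≤⁺ reaches-refl , proj₁ (∈-tabulate-does⁻ isTop? s∈tops))

      only-top : ∀ {s} → s ∈ tops → s ≡ i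
      only-top {s} s∈ with s Fin.≟ i
      ... | yes s≡i = s≡i
      ... | no s≢i  = ⊥-elim (proj₂ (proj₂ p-isBTree) tops (distinct⇒2≤∣p∣ tops s∈ i-isTop s≢i)
                                     tops-incomparable unionBelow-tops∈B)

      block⊆T≤ : block ranking i ⊆ T≤ i
      block⊆T≤ x∈ = let s , s∈ , x→s = top-above x∈ in ∈T≤⁺ (subst (Reaches _) (only-top s∈) x→s)

    treeOf-ranking : treeOf ranking ≡ p
    treeOf-ranking = lookup-extensionality parent-agrees
      where
      open TreeOfPermutation ranking ranking-isPerm using (parent-if-least; root-if-no-candidate)
      block⇒reaches : ∀ {x j} → x ∈ block ranking j → Reaches x j
      block⇒reaches {j = j} = ∈T≤⁻ ∘ Tops.block⊆T≤ j
      parent-agrees : ∀ x → lookup (treeOf ranking) x ≡ lookup p x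
      parent-agrees x with lookup p x in eq
      ... | just q  = parent-if-least
            ( (λ q≡x → parent-irreflexive (subst (λ z → lookup p x ≡ just z) q≡x eq))
            , T≤⊆block q (∈T≤⁺ (reaches-parent eq)))
            (λ j (j≢x , x∈j) → T≤⊆block j (∈T≤⁺ (reaches-via-parent (block⇒reaches x∈j) (j≢x ∘ sym) eq)))
      ... | nothing = root-if-no-candidate (λ j (j≢x , x∈j) → j≢x (sym (reaches-from-root eq (block⇒reaches x∈j))))

  candidate-transport : ∀ {a b} → (∀ i → block a i ≡ block b i) → ∀ {x j} → Candidate a x j → Candidate b x j
  candidate-transport same {x} {j} (j≢x , x∈j) = j≢x , subst (x ∈_) (same j) x∈j

  sameBlocks⇒sameTree : ∀ {a b} → IsPerm a → IsPerm b → (∀ i → block a i ≡ block b i) → treeOf a ≡ treeOf b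
  sameBlocks⇒sameTree {a} {b} a-isPerm b-isPerm same = lookup-extensionality parent-agrees
    where
    open TreeOfPermutation
    parent-agrees : ∀ x → lookup (treeOf a) x ≡ lookup (treeOf b) x
    parent-agrees x with lookup (treeOf b) x in eq
    ... | just q  = parent-if-least a a-isPerm
                      (candidate-transport {b} {a} (sym ∘ same) (parent-candidate b b-isPerm eq))
                      (λ j cj → subst (q ∈_) (sym (same j))
                                      (parent∈block b b-isPerm eq (candidate-transport {a} {b} same cj)))
    ... | nothing = root-if-no-candidate a a-isPerm
                      (λ j cj → root-no-candidate b b-isPerm eq (candidate-transport {a} {b} same cj))

  sameTree⇒sameCone : ∀ {a b} → IsPerm a → IsPerm b → treeOf a ≡ treeOf b → SameCone a b
  sameTree⇒sameCone {a} {b} a-isPerm b-isPerm eq = sameBlocks⇒sameCone {a} {b} λ i → begin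
    block a i           ≡⟨ TreeOfPermutation.T≤≡block a a-isPerm i ⟨
    Tree.T≤ (treeOf a) i ≡⟨ cong (λ t → Tree.T≤ t i) eq ⟩
    Tree.T≤ (treeOf b) i ≡⟨ TreeOfPermutation.T≤≡block b b-isPerm i ⟩
    block b i           ∎
    where open ≡-Reasoning

  blocks : Ranking n → Vec (Subset n) n
  blocks r = tabulate (block r)

  cones-isPerm : All IsPerm cones
  cones-isPerm = All.tabulate (perms-isPerm ∘ AnyP.deduplicate⁻ sameCone?)

  parentChoices : List (Maybe (Fin n))
  parentChoices = nothing ∷ map just (allFin n)

  ∈-parentChoices : ∀ m → m ∈ₗ parentChoices
  ∈-parentChoices nothing  = here refl
  ∈-parentChoices (just x) = there (∈-map⁺ just (∈-allFin x))

  bTrees-unique : Unique bTrees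
  bTrees-unique = UniqueP.filter⁺ isBTree? (allVecsOver-unique parentChoices-unique n)
    where
    parentChoices-unique : Unique parentChoices
    parentChoices-unique =
      AllP.map⁺ (All.universal (λ _ ()) (allFin n)) ∷ UniqueP.map⁺ MaybeP.just-injective (UniqueP.allFin⁺ n)

  treesOfCones↭bTrees : IsConnected B → map treeOf cones ↭ bTrees
  treesOfCones↭bTrees conn = Unique-↭
    (map-Unique treeOf (λ {a} {b} → sameTree⇒sameCone {a} {b}) cones-isPerm (deduplicate-AllPairs sameCone? (perms n)))
    bTrees-unique tree∈bTrees bTree∈trees
    where
    tree∈bTrees : ∀ {t} → t ∈ₗ map treeOf cones → t ∈ₗ bTrees
    tree∈bTrees t∈ with ∈-map⁻ treeOf t∈
    ... | r , r∈ , refl = ∈-filter⁺ isBTree? (∈-allVecsOver parentChoices (treeOf r) (∈-parentChoices ∘ _))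
                            (TreeOfPermutation.WithRoot.isBTree r (All.lookup cones-isPerm r∈) conn)
    bTree∈trees : ∀ {t} → t ∈ₗ bTrees → t ∈ₗ map treeOf cones
    bTree∈trees {t} t∈ =
      let open RankingOfBTree t (proj₂ (∈-filter⁻ isBTree? {xs = allVecsOver parentChoices n} t∈))
          r₀ , r₀∈ , blocks≡ = deduplicate-representative sameCone? blocks
                                 (λ {a} {b} same → VecP.tabulate-cong (sameCone⇒sameBlocks {a} {b} same))
                                 (∈-perms ranking ranking-isPerm)
          same : ∀ i → block r₀ i ≡ block ranking i
          same i = trans (sym (VecP.lookup∘tabulate (block r₀) i))
                         (trans (cong (λ v → lookup v i) blocks≡) (VecP.lookup∘tabulate (block ranking) i))
      in subst (_∈ₗ map treeOf cones)
               (trans (sameBlocks⇒sameTree (All.lookup cones-isPerm r₀∈) ranking-isPerm same) treeOf-ranking)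
               (∈-map⁺ treeOf r₀∈)

  coneStatistics≡treeStatistics : IsConnected B → ∀ {r ρ} → IsPerm r
    → IsMinimalRankFunction (λ i j → i ≤Q[ r ] j) ρ
    → (desPoset (λ i j → i ≤Q[ r ] j) (≤Q? r) , majPoset (λ i j → i ≤Q[ r ] j) (≤Q? r) ρ)
      ≡ (Tree.desTree (treeOf r) , Tree.majTree (treeOf r))
  coneStatistics≡treeStatistics conn {r} r-isPerm ρ-minimal =
    cong₂ _,_ desPoset≡desTree (majPoset≡majTree conn ρ-minimal)
    where open PosetOfCone r r-isPerm

proposition4p8 : {n : ℕ} (B : Pred (Subset n) 0ℓ) (B? : Decidable B)
    → IsBuildingSet B → IsConnected B
    → (ρ : Ranking n → Fin n → ℕ)
    → (∀ r → IsPerm r → IsMinimalRankFunction (λ i j → Nesto._≤Q[_]_ B B? i r j) (ρ r))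
    → ∀ a b → Nesto.hB B B? ρ a b ≡ BTrees.treePoly B B? a b
proposition4p8 {n} B B? isB conn ρ ρ-minimal a b = begin
  monomialSum (map coneStatistics cones) a b
    ≡⟨ cong (λ ws → monomialSum ws a b) statistics-agree ⟩
  monomialSum (map treeStatistics (map treeOf cones)) a b
    ≡⟨ monomialSum-↭ (PermP.map⁺ treeStatistics (treesOfCones↭bTrees conn)) a b ⟩
  monomialSum (map treeStatistics bTrees) a b
    ∎
  where
  open ≡-Reasoning
  open Nesto B B?
  open BTrees B B?
  open NormalFan B B? isB

  coneStatistics : Ranking n → ℕ × ℕ
  coneStatistics r = desPoset (λ i j → i ≤Q[ r ] j) (≤Q? r) , majPoset (λ i j → i ≤Q[ r ] j) (≤Q? r) (ρ r)

  treeStatistics : ParentVec n → ℕ × ℕ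
  treeStatistics t = Tree.desTree t , Tree.majTree t

  statistics-agree : map coneStatistics cones ≡ map treeStatistics (map treeOf cones)
  statistics-agree = trans
    (ListP.map-cong-local (All.map
      (λ {r} r-isPerm → coneStatistics≡treeStatistics conn {r} {ρ r} r-isPerm (ρ-minimal r r-isPerm)) cones-isPerm))
    (ListP.map-∘ cones)
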